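{- Let $J$ be a core join-calculus process and let $N(J) = (P, T, m_0)$ be its Petri net semantics. Then: (1) for every place $p \in m_0$, the preset $\bullet p = \{ t \in T \mid p \in t\bullet \}$ is empty; (2) for every place $p \in P$, $|\bullet p| \leq 1$; (3) the transitive closure $F^+$ of the arc relation $F = \{(p,t) \in P \times T \mid p \in \bullet t\} \cup \{(t,p) \in T \times P \mid p \in t\bullet\}$ is irreflexive.
   Context: Names: an infinite set $\mathcal N$. Core join processes are generated by $P ::= 0 \mid x\langle v\rangle \mid P \,|\, P \mid \mathsf{def}\ x\langle u\rangle | y\langle v\rangle \triangleright P \ \mathsf{in}\ P$ with $x,y,u,v \in \mathcal N$. A join definition is $D = x\langle u\rangle | y\langle v\rangle \triangleright R$; $\mathcal D$ is the set of join definitions; its defined variables are $\mathrm{dv}(D) = \{x,y\}$. Stacks over $\mathcal D$: a stack is either empty $\bot$ or $[e, s']$ with $e \in \mathcal D$ and $s'$ a stack; $\mathcal S_{\mathcal D}$ is the set of stacks. Operations: $s\top$ is $e$ if $s=[e,s']$ and a special symbol $\varepsilon$ if $s=\bot$; $s\,\mathrm{push}\,e = [e,s]$; $s\,\mathrm{pop}$ is $s'$ if $s=[e,s']$ and $\bot$ if $s=\bot$. Convention: $\mathrm{dv}(\varepsilon)$ contains every name. Places: the universe of places is $\mathcal P = \{x\langle v\rangle \mid x,v\in\mathcal N\} \times \mathcal S_{\mathcal D} \times \mathcal S_{\mathcal D}$. For $f:\mathcal N \to \mathcal N \times \mathcal S_{\mathcal D}$ write $f = (f^1,f^2)$ for its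 two components; $f_\bot(n) = (n,\bot)$. For a name $n$, $g_n(f)(n) = (f^1(n), f^2(n)\,\mathrm{pop})$ and $g_n(f)(m) = f(m)$ for $m\neq n$. Decomposition $dec(P,f)$ (a finite multiset of places; distinct occurrences are treated as distinct places, equality being up to isomorphism), defined inductively: $dec(0,f)=\emptyset$; $dec(P|Q,f) = dec(P,f)\uplus dec(Q,f)$; $dec(\mathsf{def}\ D\ \mathsf{in}\ P, f) = dec(P, (\mathrm{id}\times \mathrm{push}\,D)\circ f)$; and $dec(x\langle v\rangle, f)$ equals $dec(x\langle v\rangle, g_x(f))$ if $f^1(x)\notin \mathrm{dv}(f^2(x)\top)$, else $dec(x\langle v\rangle, g_v(f))$ if $f^1(v)\notin\mathrm{dv}(f^2(v)\top)$, and otherwise the single place $(f^1(x)\langle f^1(v)\rangle, f^2(x), f^2(v))$. Petri nets: a labeled net is $(P,T)$ with $P \subseteq \mathcal P$ and $T \subseteq 2^P \times \mathcal D \times 2^P$; for $t=(A,D,B)$, $\bullet t = A$, $t\bullet = B$, label $l(t)=D$. For a place $p$, $\bullet p = \{t \mid p \in t\bullet\}$, $p\bullet = \{t \mid p\in\bullet t\}$, and for a set $P'$ of places $\bullet P' = \bigcup_{p\in P'}\bullet p$. A Petri net $(P,T,m_0)$ adds an initial marking $m_0$ (a multiset over $P$). Transition rule: a net $(P,T,m_0)$ satisfies it iff for every two places $p = (x\langle a\rangle, s, s_a)$ and $q = (y\langle b\rangle, s, s_b)$ in $P$ with $s\top = x\langle u\rangle | y\langle v\rangle \triangleright R$, there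 is a transition $t = (\{p,q\}, x\langle u\rangle|y\langle v\rangle\triangleright R, P') \in T$ with $P' = dec(R, f_t)$, $P' \cap m_0 = \emptyset$ and $\bullet P' = \{t\}$, where $f_t(u) = (a,s_a)$, $f_t(v) = (b,s_b)$ and $f_t(n) = (n,s)$ for all other names $n$. $N(J) = (P,T,m_0)$ is the smallest Petri net such that $m_0 = dec(J,f_\bot) \subseteq P$ and the transition rule is satisfied. -}

module Defs where

open import Data.Nat using (ℕ; zero; suc; _+_)
open import Data.Nat.Properties using (_≟_)
open import Data.Bool using (Bool; true; false; if_then_else_; _∨_)
open import Data.List using (List; []; _∷_; _++_; length; lookup)
open import Data.Maybe using (Maybe; just; nothing)
open import Data.Fin using (Fin)
open import Data.Product using (Σ; _×_; _,_; proj₁; proj₂)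
open import Data.Sum using (_⊎_)
open import Relation.Nullary using (¬_)
open import Relation.Nullary.Decidable using (⌊_⌋)
open import Relation.Binary.PropositionalEquality using (_≡_)
open import Relation.Binary.Construct.Closure.Transitive using (TransClosure)

Name : Set
Name = ℕ

mutual
  data Proc : Set where
    nil : Proc
    msg : Name → Name → Proc
    par : Proc → Proc → Proc
    def : JoinDef → Proc → Proc

  -- join definition  x⟨u⟩ | y⟨v⟩ ▷ R   (constructor arguments x u y v R)
  data JoinDef : Set where
    jdef : Name → Name → Name → Name → Proc → JoinDef

jx jy ju jv : JoinDef → Name
jx (jdef x u y v R) = x
ju (jdef x u y v R) = u
jy (jdef x u y v R) = y
jv (jdef x u y v R) = v

jbody : JoinDef → Proc
jbody (jdef x u y v R) = R

-- Stacks over 𝒟 : ⊥ = [], [e , s'] = e ∷ s'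

Stack : Set
Stack = List JoinDef

-- s⊤ ; the special symbol ε is `nothing`
top : Stack → Maybe JoinDef
top []      = nothing
top (e ∷ s) = just e

push : Stack → JoinDef → Stack
push s e = e ∷ s

pop : Stack → Stack
pop []      = []
pop (e ∷ s) = s

-- Boolean membership n ∈ dv(e), with dv(ε) = all names
inDv : Name → Maybe JoinDef → Bool
inDv n nothing  = true
inDv n (just D) = ⌊ n ≟ jx D ⌋ ∨ ⌊ n ≟ jy D ⌋

-- Place labels  (x⟨v⟩, s, s') ∈ 𝒫

record PLabel : Set where
  constructor plabel
  field
    chan  : Name
    arg   : Name
    stk   : Stack
    stkA  : Stack
open PLabel public

Env : Set
Env = Name → Name × Stack

f⊥ : Env
f⊥ n = (n , [])

g : Name → Env → Env
g n f m with ⌊ m ≟ n ⌋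
... | true  = (proj₁ (f m) , pop (proj₂ (f m)))
... | false = f m

pushEnv : JoinDef → Env → Env
pushEnv D f m = (proj₁ (f m) , push (proj₂ (f m)) D)

-- Every recursive call pops a
-- nonempty stack (an empty stack has top ε and dv(ε) contains every
-- name), so fuel = |f²(x)| + |f²(v)| suffices for the recursion of the
-- paper to terminate; with this fuel the result coincides with it.
decMsgF : ℕ → Env → Name → Name → PLabel
decMsgF zero    f x v = plabel (proj₁ (f x)) (proj₁ (f v)) (proj₂ (f x)) (proj₂ (f v))
decMsgF (suc k) f x v =
  if inDv (proj₁ (f x)) (top (proj₂ (f x)))
  then (if inDv (proj₁ (f v)) (top (proj₂ (f v)))
        then plabel (proj₁ (f x)) (proj₁ (f v)) (proj₂ (f x)) (proj₂ (f v))
        else decMsgF k (g v f) x v)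
  else decMsgF k (g x f) x v

decMsg : Env → Name → Name → PLabel
decMsg f x v = decMsgF (length (proj₂ (f x)) + length (proj₂ (f v))) f x v

-- dec(P, f) as a finite multiset (list) of place labels
dec : Proc → Env → List PLabel
dec nil       f = []
dec (msg x v) f = decMsg f x v ∷ []
dec (par P Q) f = dec P f ++ dec Q f
dec (def D P) f = dec P (pushEnv D f)

fT : JoinDef → PLabel → PLabel → Env
fT D p q n with ⌊ n ≟ ju D ⌋ | ⌊ n ≟ jv D ⌋
... | true  | _     = (arg p , stkA p)
... | false | true  = (arg q , stkA q)
... | false | false = (n , stk p)

Matches : PLabel → PLabel → JoinDef → Set
Matches p q D = (stk p ≡ stk q) × (top (stk p) ≡ just D) × (jx D ≡ chan p) × (jy D ≡ chan q)

-- Places are occurrences: an initial place is an occurrence (index) in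
-- m₀ = dec(J, f⊥); every transition t gets its own fresh output places
-- (indices into dec(R, f_t)), realising P' ∩ m₀ = ∅ and •P' = {t}.
-- The smallest net satisfying the rule is the inductive-recursive
-- family below: all places and transitions generated from m₀.

module Net (J : Proc) where

  m₀ : List PLabel
  m₀ = dec J f⊥

  mutual
    data Place : Set where
      init : Fin (length m₀) → Place
      out  : (t : Trans) → Fin (length (postL t)) → Place

    data Trans : Set where
      fire : (p q : Place) → (D : JoinDef) → Matches (lab p) (lab q) D → Trans

    lab : Place → PLabel
    lab (init i)  = lookup m₀ i
    lab (out t i) = lookup (postL t) i

    postL : Trans → List PLabel
    postL (fire p q D _) = dec (jbody D) (fT D (lab p) (lab q))

  tlab : Trans → JoinDef
  tlab (fire _ _ D _) = D

  _∈pre_ : Place → Trans → Set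
  r ∈pre fire p q _ _ = (r ≡ p) ⊎ (r ≡ q)

  _∈post_ : Place → Trans → Set
  r ∈post t = Σ (Fin (length (postL t))) (λ i → out t i ≡ r)

  _∈m₀ : Place → Set
  r ∈m₀ = Σ (Fin (length m₀)) (λ i → init i ≡ r)

  Node : Set
  Node = Place ⊎ Trans

  data F : Node → Node → Set where
    pt : ∀ {p t} → p ∈pre t  → F (_⊎_.inj₁ p) (_⊎_.inj₂ t)
    tp : ∀ {t p} → p ∈post t → F (_⊎_.inj₂ t) (_⊎_.inj₁ p)

  F⁺ : Node → Node → Set
  F⁺ = TransClosure F

module Submission where

-- The Petri net N(J) is built as an inductive family: every place is
-- either an occurrence `init i` of the initial marking m₀ or an output
-- occurrence `out t i` created by exactly one transition t, and every
-- transition `fire p q D _` is created from its two input places.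
--
-- (1) and (2) are therefore structural: an initial place is never of the
--     form `out t i`, and `out t i ≡ out t′ j` forces t ≡ t′ (constructor
--     disjointness and injectivity).  This is the net-level content of the
--     side conditions P′ ∩ m₀ = ∅ and •P′ = {t} of the transition rule.
-- (3) follows from a general fact about relations: if a rank function into
--     ℕ strictly increases along every step of R, then R⁺ is irreflexive.
--     The generation depth of nodes (initial places at depth 0, a
--     transition one above its deeper input, an output place one above its
--     transition) is such a rank for the arc relation F.

open import Defs
open import Relation.Nullary using (¬_)
open import Relation.Binary.PropositionalEquality using (_≡_; refl)
open import Relation.Binary.Core using (Rel)
open import Relation.Binary.Construct.Closure.Transitive using (TransClosure; [_]; _∷_)
open import Data.Product using (_×_; _,_)
open import Data.Sum using (inj₁; inj₂)
open import Data.Nat using (ℕ; zero; suc; _⊔_; _<_; s≤s)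
open import Data.Nat.Properties using (<-trans; <-irrefl; m≤m⊔n; m≤n⊔m; n<1+n)

module Ranked {a ℓ} {A : Set a} (_R_ : Rel A ℓ) (rank : A → ℕ)
              (rank-increases : ∀ {x y} → x R y → rank x < rank y) where

  rank-increases⁺ : ∀ {x y} → TransClosure _R_ x y → rank x < rank y
  rank-increases⁺ [ xRy ]      = rank-increases xRy
  rank-increases⁺ (xRy ∷ yR⁺z)   = <-trans (rank-increases xRy) (rank-increases⁺ yR⁺z)

  acyclic : ∀ x → ¬ TransClosure _R_ x x
  acyclic x xR⁺x = <-irrefl refl (rank-increases⁺ xR⁺x)

module NetProperties (J : Proc) where
  open Net J

  initial-no-producer : ∀ (p : Place) → p ∈m₀ → ∀ (t : Trans) → ¬ (p ∈post t)
  initial-no-producer p (i , refl) t (j , ())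

  unique-producer : ∀ (p : Place) (t t′ : Trans) → p ∈post t → p ∈post t′ → t ≡ t′
  unique-producer p t t′ (i , refl) (j , refl) = refl

  mutual
    depth : Place → ℕ
    depth (init i)  = 0
    depth (out t i) = suc (depthT t)

    depthT : Trans → ℕ
    depthT (fire p q D _) = suc (depth p ⊔ depth q)

  depthN : Node → ℕ
  depthN (inj₁ p) = depth p
  depthN (inj₂ t) = depthT t

  arc-increases-depth : ∀ {m n} → F m n → depthN m < depthN n
  arc-increases-depth (pt {t = fire p q D _} (inj₁ refl)) = s≤s (m≤m⊔n (depth p) (depth q))
  arc-increases-depth (pt {t = fire p q D _} (inj₂ refl)) = s≤s (m≤n⊔m (depth p) (depth q))
  arc-increases-depth (tp (i , refl))                     = n<1+n (depthT _)

  F⁺-irreflexive : ∀ (n : Node) → ¬ F⁺ n n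
  F⁺-irreflexive = Ranked.acyclic F depthN arc-increases-depth

mainTheorem1 : (J : Proc) →
    let open Net J in
    (∀ (p : Place) → p ∈m₀ → ∀ (t : Trans) → ¬ (p ∈post t))
    × (∀ (p : Place) (t t′ : Trans) → p ∈post t → p ∈post t′ → t ≡ t′)
    × (∀ (n : Node) → ¬ F⁺ n n)
mainTheorem1 J = initial-no-producer , unique-producer , F⁺-irreflexive
  where open NetProperties J
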